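{- Let $S=L\cdot R$ be a string such that the set of symbols occurring in $L$ and the set of symbols occurring in $R$ are disjoint. Then $\mathsf{slp}(S)\ge\mathsf{slp}(L)+\mathsf{slp}(R)$.
   Context: A straight-line program (SLP) is a context-free grammar generating exactly one string in which every rule has a right-hand side of exactly two symbols; $\mathsf{slp}(T)$ is the minimum number of symbols (terminals and nonterminals) in an SLP generating the nonempty string $T$ (a single-symbol string is generated by the terminal itself). $L$ and $R$ are nonempty. -}

module Defs where

open import Data.Nat using (ℕ; zero; suc; _+_; _≤_)
open import Data.Fin using (Fin; zero; suc)
open import Data.List using (List; []; _∷_; [_]; _++_; length; deduplicate)
open import Data.Sum using (_⊎_; inj₁; inj₂)
open import Data.Product using (_×_; _,_; Σ)
open import Relation.Binary.Definitions using (DecidableEquality)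
open import Relation.Binary.PropositionalEquality using (_≡_)

-- Symbols available to a rule when k nonterminals have been defined before it:
-- a terminal (inj₁ a) or one of the k earlier nonterminals (inj₂ i).
Sym : Set → ℕ → Set
Sym A k = A ⊎ Fin k

-- The rule part of an SLP with k nonterminals X₀,…,X_{k-1}; rule X_i → α β
-- with α, β ∈ Sym A i (so the grammar is acyclic and each rule has exactly
-- two right-hand-side symbols).
data Rules (A : Set) : ℕ → Set where
  []  : Rules A zero
  _▷_ : ∀ {k} → Rules A k → Sym A k × Sym A k → Rules A (suc k)

expand : ∀ {A k} → Rules A k → Sym A k → List A
expand rs (inj₁ a) = [ a ]
expand (rs ▷ (x , y)) (inj₂ zero) = expand rs x ++ expand rs y
expand (rs ▷ r) (inj₂ (suc i)) = expand rs (inj₂ i)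

-- An SLP: k nonterminal rules plus a start symbol (a terminal start symbol
-- covers the single-symbol case).
record SLP (A : Set) : Set where
  constructor slpG
  field
    nNT   : ℕ
    rules : Rules A nNT
    start : Sym A nNT
open SLP public

generates : ∀ {A} → SLP A → List A
generates G = expand (rules G) (start G)

termsSym : ∀ {A k} → Sym A k → List A
termsSym (inj₁ a) = [ a ]
termsSym (inj₂ _) = []

termsRules : ∀ {A k} → Rules A k → List A
termsRules [] = []
termsRules (rs ▷ (x , y)) = termsRules rs ++ termsSym x ++ termsSym y

size : ∀ {A} → DecidableEquality A → SLP A → ℕ
size _≟_ G = length (deduplicate _≟_ (termsRules (rules G) ++ termsSym (start G)))
           + nNT G

IsSlp : ∀ {A} → DecidableEquality A → List A → ℕ → Set
IsSlp {A} _≟_ T m =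
  Σ (SLP A) (λ G → (generates G ≡ T) × (size _≟_ G ≡ m))
  × (∀ (G : SLP A) → generates G ≡ T → m ≤ size _≟_ G)

-- Take a smallest SLP G for L ++ R and delete from it, once, all letters not
-- in L and, once, all letters in L.  Deleting the letters outside a set P is
-- a "projection": every nonterminal X → α β of G is mapped to a symbol of a
-- new grammar deriving the P-letters of X's expansion; X gets a fresh rule
-- only when both α and β keep some P-letter, otherwise X is identified with
-- the image of the surviving child (or vanishes).  The projection of G
-- therefore generates the P-letters of L ++ R, uses only terminals of G that
-- satisfy P, and has at most one rule per rule of G.
--
-- Every word derived from the start symbol is a factor of L ++ R, so its
-- L-letters precede its other letters.  Hence if both children of such a
-- rule contain L-letters, the left one contains no other letter, and the
-- projection onto the non-L letters may refuse that rule a fresh rule.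
-- With this refusal each rule of G is charged to at most one of the two
-- projections: together they have at most as many nonterminals as G, and
-- their terminal sets are disjoint parts of G's.
module Submission where

open import Defs
open import Algebra.Properties.CommutativeSemigroup using (interchange)
open import Data.Bool using (Bool; true; false)
open import Data.Empty using (⊥; ⊥-elim)
open import Data.Fin using (zero; suc)
open import Data.List using (List; []; _∷_; _++_; length; deduplicate; filter)
open import Data.List.Properties using (length-++; ++-conicalˡ; ++-identityʳ; filter-++; filter-all; filter-none; ≡-dec)
open import Data.List.Membership.Propositional using (_∈_)
open import Data.List.Membership.Propositional.Properties
  using (∈-++⁺ˡ; ∈-++⁺ʳ; ∈-++⁻; ∈-∃++; ∈-filter⁻; ∈-deduplicate⁺; ∈-deduplicate⁻)
open import Data.List.Relation.Binary.Subset.Propositional using (_⊆_)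
open import Data.List.Relation.Binary.Subset.Propositional.Properties
  using (⊆-refl; ⊆-trans; ⊆-reflexive; xs⊆xs++ys; xs⊆ys++xs; ++⁺ˡ; ++⁺ʳ; filter-⊆; filter⁺′)
open import Data.List.Relation.Unary.All as All using (All; []; _∷_)
import Data.List.Relation.Unary.All.Properties as All
open import Data.List.Relation.Unary.AllPairs using (AllPairs; []; _∷_)
open import Data.List.Relation.Unary.AllPairs.Properties using () renaming (++⁺ to allPairs-++⁺)
open import Data.List.Relation.Unary.Any using (here; there)
open import Data.List.Relation.Unary.Unique.Propositional using (Unique)
open import Data.List.Relation.Unary.Unique.Propositional.Properties using () renaming (++⁺ to unique-++⁺)
open import Data.List.Relation.Unary.Unique.DecPropositional.Properties using (deduplicate-!)
open import Data.Maybe using (Maybe; just; nothing; maybe)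
import Data.Maybe as Maybe
open import Data.Nat using (ℕ; zero; suc; _+_; _≤_; z≤n; s≤s)
open import Data.Nat.Properties
  using (≤-refl; ≤-trans; ≤-reflexive; n≤1+n; +-mono-≤; +-monoʳ-≤; +-suc; +-commutativeSemigroup; module ≤-Reasoning)
open import Data.Product using (_×_; _,_; Σ; proj₁; proj₂)
open import Data.Sum using (_⊎_; inj₁; inj₂; [_,_]′)
import Data.Sum as Sum
open import Data.Unit using (⊤; tt)
open import Function using (_∘_)
open import Relation.Binary.Definitions using (DecidableEquality)
open import Relation.Binary.PropositionalEquality using (_≡_; _≢_; refl; sym; trans; cong; cong₂; subst; module ≡-Reasoning)
open import Relation.Nullary using (¬_; Dec; yes; no; does)
open import Relation.Nullary.Decidable using (dec-false; _⊎-dec_)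
open import Relation.Unary using (Decidable)
open import Relation.Unary.Properties using (∁?)

++-⊆ : {A : Set} {xs ys zs : List A} → xs ⊆ zs → ys ⊆ zs → xs ++ ys ⊆ zs
++-⊆ {xs = xs} xs⊆zs ys⊆zs m = [ xs⊆zs , ys⊆zs ]′ (∈-++⁻ xs m)

allPairs-++⁻ : {A : Set} {R : A → A → Set} (xs : List A) {ys : List A} → AllPairs R (xs ++ ys) →
  AllPairs R xs × AllPairs R ys × All (λ x → All (R x) ys) xs
allPairs-++⁻ []       pairs = [] , pairs , []
allPairs-++⁻ (x ∷ xs) (x≺ ∷ pairs) =
  let (xs-pairs , ys-pairs , across) = allPairs-++⁻ xs pairs
  in (All.++⁻ˡ xs x≺ ∷ xs-pairs) , ys-pairs , (All.++⁻ʳ xs x≺ ∷ across)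

allPairs-of : {A : Set} {R : A → A → Set} {xs : List A} → (∀ {a b} → a ∈ xs → b ∈ xs → R a b) → AllPairs R xs
allPairs-of {xs = []}     _ = []
allPairs-of {xs = x ∷ xs} related =
  All.tabulate (related (here refl) ∘ there) ∷ allPairs-of (λ a∈xs b∈xs → related (there a∈xs) (there b∈xs))

unique-⊆-length : {A : Set} {xs ys : List A} → Unique xs → xs ⊆ ys → length xs ≤ length ys
unique-⊆-length [] _ = z≤n
unique-⊆-length {xs = x ∷ xs} (x∉xs ∷ xs!) xs⊆ys with ∈-∃++ (xs⊆ys (here refl))
... | us , vs , refl = begin
  suc (length xs)             ≤⟨ s≤s (unique-⊆-length xs! xs⊆us++vs) ⟩
  suc (length (us ++ vs))     ≡⟨ cong suc (length-++ us) ⟩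
  suc (length us + length vs) ≡⟨ +-suc (length us) (length vs) ⟨
  length us + suc (length vs) ≡⟨ length-++ us ⟨
  length (us ++ x ∷ vs)       ∎
  where
  open ≤-Reasoning
  -- x is not among xs, so xs avoids the removed copy of x.
  xs⊆us++vs : xs ⊆ us ++ vs
  xs⊆us++vs {a} a∈xs with ∈-++⁻ us (xs⊆ys (there a∈xs))
  ... | inj₁ a∈us         = ∈-++⁺ˡ a∈us
  ... | inj₂ (here a≡x)   = ⊥-elim (All.lookup x∉xs a∈xs (sym a≡x))
  ... | inj₂ (there a∈vs) = ∈-++⁺ʳ us a∈vs

distinct-split-length : {A : Set} (_≟_ : DecidableEquality A) {P : A → Set} (P? : Decidable P)
  {xs ys zs : List A} → xs ⊆ filter P? zs → ys ⊆ filter (∁? P?) zs →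
  length (deduplicate _≟_ xs) + length (deduplicate _≟_ ys) ≤ length (deduplicate _≟_ zs)
distinct-split-length _≟_ P? {xs} {ys} {zs} xs⊆ ys⊆ = begin
  length (dedup xs) + length (dedup ys) ≡⟨ length-++ (dedup xs) ⟨
  length (dedup xs ++ dedup ys)         ≤⟨ unique-⊆-length distinct (++-⊆ (into P? xs⊆) (into (∁? P?) ys⊆)) ⟩
  length (dedup zs)                     ∎
  where
  open ≤-Reasoning
  dedup : List _ → List _
  dedup = deduplicate _≟_
  into : ∀ {ws} {Q : _ → Set} (Q? : Decidable Q) → ws ⊆ filter Q? zs → dedup ws ⊆ dedup zs
  into Q? ws⊆ = ∈-deduplicate⁺ _≟_ ∘ filter-⊆ Q? zs ∘ ws⊆ ∘ ∈-deduplicate⁻ _≟_ _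
  distinct : Unique (dedup xs ++ dedup ys)
  distinct = unique-++⁺ (deduplicate-! _≟_ xs) (deduplicate-! _≟_ ys) λ (a∈xs , a∈ys) →
    proj₂ (∈-filter⁻ (∁? P?) {xs = zs} (ys⊆ (∈-deduplicate⁻ _≟_ ys a∈ys)))
          (proj₂ (∈-filter⁻ P? {xs = zs} (xs⊆ (∈-deduplicate⁻ _≟_ xs a∈xs))))

expand-nonempty : ∀ {A k} (rs : Rules A k) (s : Sym A k) → expand rs s ≢ []
expand-nonempty rs (inj₁ a) ()
expand-nonempty (rs ▷ (x , y)) (inj₂ zero) = expand-nonempty rs x ∘ ++-conicalˡ _ (expand rs y)
expand-nonempty (rs ▷ r) (inj₂ (suc i)) = expand-nonempty rs (inj₂ i)

weaken : ∀ {A k} → Sym A k → Sym A (suc k)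
weaken = Sum.map₂ suc

expand-weaken : ∀ {A k} (rs : Rules A k) r (s : Sym A k) → expand (rs ▷ r) (weaken s) ≡ expand rs s
expand-weaken rs r (inj₁ a) = refl
expand-weaken rs r (inj₂ i) = refl

termsSym-weaken : ∀ {A k} (s : Sym A k) → termsSym (weaken s) ≡ termsSym s
termsSym-weaken (inj₁ a) = refl
termsSym-weaken (inj₂ i) = refl

terminals : ∀ {A} → SLP A → List A
terminals G = termsRules (rules G) ++ termsSym (start G)

-- Keep u v decides whether a rule whose children expand to u and v may
-- receive a fresh rule in the projection (when both children keep some
-- P-letter); a rule that is refused is simply dropped.

module Projection {A : Set} {P : A → Set} (P? : Decidable P)
                  {Keep : List A → List A → Set} (keep? : ∀ u v → Dec (Keep u v)) where

  -- A projection of k rules: a new rule set and the image of each old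
  -- symbol, nothing meaning that the symbol keeps no P-letter.
  record Proj (k : ℕ) : Set where
    constructor proj
    field
      nts    : ℕ
      prules : Rules A nts
      image  : Sym A k → Maybe (Sym A nts)
  open Proj public

  expandM : ∀ {m} → Rules A m → Maybe (Sym A m) → List A
  expandM rs = maybe (expand rs) []

  termsM : ∀ {m} → Maybe (Sym A m) → List A
  termsM = maybe termsSym []

  newest : ∀ {k} → Sym A (suc k)
  newest = inj₂ zero

  extend : ∀ {k m} → (Sym A k → Maybe (Sym A m)) → Maybe (Sym A m) → Sym A (suc k) → Maybe (Sym A m)
  extend g z (inj₁ a)       = g (inj₁ a)
  extend g z (inj₂ zero)    = z
  extend g z (inj₂ (suc i)) = g (inj₂ i)

  extend-weaken : ∀ {k m} (g : Sym A k → Maybe (Sym A m)) z s → extend g z (weaken s) ≡ g s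
  extend-weaken g z (inj₁ a) = refl
  extend-weaken g z (inj₂ i) = refl

  addRule : ∀ {k} (Q : Proj k) → Maybe (Sym A (nts Q)) → Maybe (Sym A (nts Q)) → Bool → Proj (suc k)
  addRule (proj m rs g) (just x) (just y) true  = proj (suc m) (rs ▷ (x , y)) (extend (Maybe.map weaken ∘ g) (just newest))
  addRule (proj m rs g) (just x) (just y) false = proj m rs (extend g nothing)
  addRule (proj m rs g) (just x) nothing  _     = proj m rs (extend g (just x))
  addRule (proj m rs g) nothing  my       _     = proj m rs (extend g my)

  projectTerminal : Sym A 0 → Maybe (Sym A 0)
  projectTerminal (inj₁ a) with P? a
  ... | yes _ = just (inj₁ a)
  ... | no _  = nothing
  projectTerminal (inj₂ ())

  project : ∀ {k} → Rules A k → Proj k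
  project [] = proj 0 [] projectTerminal
  project (rs ▷ (x , y)) =
    addRule (project rs) (image (project rs) x) (image (project rs) y) (does (keep? (expand rs x) (expand rs y)))

  expandM-weaken : ∀ {m} (rs : Rules A m) r (ms : Maybe (Sym A m)) →
    expandM (rs ▷ r) (Maybe.map weaken ms) ≡ expandM rs ms
  expandM-weaken rs r nothing  = refl
  expandM-weaken rs r (just s) = expand-weaken rs r s

  addRule-expand-weaken : ∀ {k} (Q : Proj k) mx my b (s : Sym A k) →
    let Q′ = addRule Q mx my b in expandM (prules Q′) (image Q′ (weaken s)) ≡ expandM (prules Q) (image Q s)
  addRule-expand-weaken (proj m rs g) (just x) (just y) true  s =
    trans (cong (expandM (rs ▷ (x , y))) (extend-weaken _ _ s)) (expandM-weaken rs (x , y) (g s))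
  addRule-expand-weaken (proj m rs g) (just x) (just y) false s = cong (expandM rs) (extend-weaken g _ s)
  addRule-expand-weaken (proj m rs g) (just x) nothing  _     s = cong (expandM rs) (extend-weaken g _ s)
  addRule-expand-weaken (proj m rs g) nothing  my       _     s = cong (expandM rs) (extend-weaken g _ s)

  addRule-expand-newest : ∀ {k} (Q : Proj k) mx my {K : Set} (d : Dec K) {u v : List A} →
    expandM (prules Q) mx ≡ u → expandM (prules Q) my ≡ v → (¬ K → u ≢ [] → v ≢ [] → ⊥) →
    let Q′ = addRule Q mx my (does d) in expandM (prules Q′) (image Q′ newest) ≡ u ++ v
  addRule-expand-newest (proj m rs g) (just x) (just y) (yes _) ex ey refused = cong₂ _++_ ex ey
  addRule-expand-newest (proj m rs g) (just x) (just y) (no ¬k) ex ey refused =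
    ⊥-elim (refused ¬k (expand-nonempty rs x ∘ trans ex) (expand-nonempty rs y ∘ trans ey))
  addRule-expand-newest (proj m rs g) (just x) nothing  d ex ey refused =
    trans (sym (++-identityʳ (expand rs x))) (cong₂ _++_ ex ey)
  addRule-expand-newest (proj m rs g) nothing  my       d ex ey refused = cong₂ _++_ ex ey

  project-expand-weaken : ∀ {k} (rs : Rules A k) r (s : Sym A k) →
    expandM (prules (project (rs ▷ r))) (image (project (rs ▷ r)) (weaken s))
      ≡ expandM (prules (project rs)) (image (project rs) s)
  project-expand-weaken rs (x , y) =
    addRule-expand-weaken (project rs) (image (project rs) x) (image (project rs) y) (does (keep? (expand rs x) (expand rs y)))

  termsM-weaken : ∀ {m} (ms : Maybe (Sym A m)) → termsM (Maybe.map weaken ms) ≡ termsM ms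
  termsM-weaken nothing  = refl
  termsM-weaken (just s) = termsSym-weaken s

  addRule-terms-weaken : ∀ {k} (Q : Proj k) mx my b (s : Sym A k) →
    termsM (image (addRule Q mx my b) (weaken s)) ≡ termsM (image Q s)
  addRule-terms-weaken (proj m rs g) (just x) (just y) true  s =
    trans (cong termsM (extend-weaken _ _ s)) (termsM-weaken (g s))
  addRule-terms-weaken (proj m rs g) (just x) (just y) false s = cong termsM (extend-weaken g _ s)
  addRule-terms-weaken (proj m rs g) (just x) nothing  _     s = cong termsM (extend-weaken g _ s)
  addRule-terms-weaken (proj m rs g) nothing  my       _     s = cong termsM (extend-weaken g _ s)

  addRule-terms-newest : ∀ {k} (Q : Proj k) mx my b →
    termsM (image (addRule Q mx my b) newest) ⊆ termsM mx ++ termsM my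
  addRule-terms-newest (proj m rs g) (just x) (just y) true  = λ ()
  addRule-terms-newest (proj m rs g) (just x) (just y) false = λ ()
  addRule-terms-newest (proj m rs g) (just x) nothing  _     = xs⊆xs++ys _ _
  addRule-terms-newest (proj m rs g) nothing  my       _     = ⊆-refl

  addRule-terms-rules : ∀ {k} (Q : Proj k) mx my b →
    termsRules (prules (addRule Q mx my b)) ⊆ termsRules (prules Q) ++ termsM mx ++ termsM my
  addRule-terms-rules (proj m rs g) (just x) (just y) true  = ⊆-refl
  addRule-terms-rules (proj m rs g) (just x) (just y) false = xs⊆xs++ys _ _
  addRule-terms-rules (proj m rs g) (just x) nothing  _     = xs⊆xs++ys _ _
  addRule-terms-rules (proj m rs g) nothing  my       _     = xs⊆xs++ys _ _

  filter-mono : ∀ {xs ys} → xs ⊆ ys → filter P? xs ⊆ filter P? ys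
  filter-mono = filter⁺′ P? P? (λ p → p)

  project-terminals : ∀ {k} (rs : Rules A k) →
      termsRules (prules (project rs)) ⊆ filter P? (termsRules rs)
    × (∀ s → termsM (image (project rs) s) ⊆ filter P? (termsRules rs ++ termsSym s))
  project-terminals [] = (λ ()) , terminal⊆
    where
    terminal⊆ : ∀ s → termsM (projectTerminal s) ⊆ filter P? (termsSym s)
    terminal⊆ (inj₁ a) with P? a
    ... | yes _ = ⊆-refl
    ... | no _  = λ ()
  project-terminals {suc k} (rs ▷ (x , y)) = rules⊆ , image⊆
    where
    Q : Proj k
    Q = project rs
    mx my : Maybe (Sym A (nts Q))
    mx = image Q x
    my = image Q y
    b : Bool
    b = does (keep? (expand rs x) (expand rs y))
    T T′ : List A
    T  = termsRules rs
    T′ = T ++ termsSym x ++ termsSym y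
    old-rules : termsRules (prules Q) ⊆ filter P? T
    old-rules = proj₁ (project-terminals rs)
    old-images : ∀ s → termsM (image Q s) ⊆ filter P? (T ++ termsSym s)
    old-images = proj₂ (project-terminals rs)

    children⊆ : termsM mx ++ termsM my ⊆ filter P? T′
    children⊆ = ++-⊆ (⊆-trans (old-images x) (filter-mono (++⁺ʳ T (xs⊆xs++ys _ _))))
                     (⊆-trans (old-images y) (filter-mono (++⁺ʳ T (xs⊆ys++xs _ _))))

    rules⊆ : termsRules (prules (addRule Q mx my b)) ⊆ filter P? T′
    rules⊆ = ⊆-trans (addRule-terms-rules Q mx my b)
                     (++-⊆ (⊆-trans old-rules (filter-mono (xs⊆xs++ys T _))) children⊆)

    older : ∀ s → termsM (image (addRule Q mx my b) (weaken s)) ⊆ filter P? (T′ ++ termsSym s)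
    older s = ⊆-trans (⊆-reflexive (addRule-terms-weaken Q mx my b s))
                      (⊆-trans (old-images s) (filter-mono (++⁺ˡ (termsSym s) (xs⊆xs++ys T _))))

    image⊆ : ∀ s → termsM (image (addRule Q mx my b) s) ⊆ filter P? (T′ ++ termsSym s)
    image⊆ (inj₁ a)       = older (inj₁ a)
    image⊆ (inj₂ (suc i)) = older (inj₂ i)
    image⊆ (inj₂ zero)    = ⊆-trans (addRule-terms-newest Q mx my b)
                                    (⊆-trans children⊆ (filter-mono (xs⊆xs++ys T′ [])))

  addRule-size : ∀ {k} (Q : Proj k) mx my b → nts (addRule Q mx my b) ≤ suc (nts Q)
  addRule-size (proj m rs g) (just x) (just y) true  = ≤-refl
  addRule-size (proj m rs g) (just x) (just y) false = n≤1+n m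
  addRule-size (proj m rs g) (just x) nothing  _     = n≤1+n m
  addRule-size (proj m rs g) nothing  my       _     = n≤1+n m

  addRule-refused : ∀ {k} (Q : Proj k) mx my → nts (addRule Q mx my false) ≡ nts Q
  addRule-refused (proj m rs g) (just x) (just y) = refl
  addRule-refused (proj m rs g) (just x) nothing  = refl
  addRule-refused (proj m rs g) nothing  my       = refl

  module Correctness (Good : List A → Set)
    (good-split : ∀ u v → Good (u ++ v) → Good u × Good v)
    (refusal-sound : ∀ u v → ¬ Keep u v → Good (u ++ v) → filter P? u ≢ [] → filter P? v ≢ [] → ⊥) where

    project-correct : ∀ {k} (rs : Rules A k) (s : Sym A k) → Good (expand rs s) →
      expandM (prules (project rs)) (image (project rs) s) ≡ filter P? (expand rs s)
    project-correct [] (inj₁ a) _ with P? a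
    ... | yes _ = refl
    ... | no _  = refl
    project-correct (rs ▷ r) (inj₁ a) good =
      trans (project-expand-weaken rs r (inj₁ a)) (project-correct rs (inj₁ a) good)
    project-correct (rs ▷ r) (inj₂ (suc i)) good =
      trans (project-expand-weaken rs r (inj₂ i)) (project-correct rs (inj₂ i) good)
    project-correct (rs ▷ (x , y)) (inj₂ zero) good =
      let (good-x , good-y) = good-split (expand rs x) (expand rs y) good
          Q = project rs
      in trans (addRule-expand-newest Q (image Q x) (image Q y) (keep? (expand rs x) (expand rs y))
                  (project-correct rs x good-x) (project-correct rs y good-y)
                  (λ ¬keep → refusal-sound _ _ ¬keep good))
               (sym (filter-++ P? (expand rs x) (expand rs y)))

    image-nonempty : ∀ {k} (rs : Rules A k) (s : Sym A k) {t} → Good (expand rs s) →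
      image (project rs) s ≡ just t → filter P? (expand rs s) ≢ []
    image-nonempty rs s {t} good image≡t =
      expand-nonempty (prules (project rs)) t
      ∘ trans (trans (cong (expandM (prules (project rs))) (sym image≡t)) (project-correct rs s good))

    project-slp : (G : SLP A) → Good (generates G) → filter P? (generates G) ≢ [] →
      Σ (SLP A) λ G′ → generates G′ ≡ filter P? (generates G)
                     × nNT G′ ≡ nts (project (rules G))
                     × terminals G′ ⊆ filter P? (terminals G)
    project-slp (slpG k rs st) good nonempty
      with image (project rs) st in image≡ | project-correct rs st good
    ... | nothing | []≡ = ⊥-elim (nonempty (sym []≡))
    ... | just t  | correct = slpG _ (prules (project rs)) t , correct , refl , terminals⊆
      where
      terminals⊆ : termsRules (prules (project rs)) ++ termsSym t ⊆ filter P? (termsRules rs ++ termsSym st)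
      terminals⊆ = ++-⊆ (⊆-trans (proj₁ (project-terminals rs)) (filter-mono (xs⊆xs++ys (termsRules rs) (termsSym st))))
                        (subst (λ ms → termsM ms ⊆ _) image≡ (proj₂ (project-terminals rs) st))

module Split {A : Set} (_≟_ : DecidableEquality A) (L R : List A)
             (disjoint : ∀ a → a ∈ L → a ∈ R → ⊥) where

  open import Data.List.Membership.DecPropositional _≟_ using (_∈?_)

  inL? : Decidable (_∈ L)
  inL? a = a ∈? L

  filter-L : filter inL? (L ++ R) ≡ L
  filter-L = begin
    filter inL? (L ++ R)               ≡⟨ filter-++ inL? L R ⟩
    filter inL? L ++ filter inL? R     ≡⟨ cong₂ _++_ (filter-all inL? (All.tabulate (λ a∈L → a∈L)))
                                                     (filter-none inL? (All.tabulate (λ a∈R a∈L → disjoint _ a∈L a∈R))) ⟩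
    L ++ []                            ≡⟨ ++-identityʳ L ⟩
    L                                  ∎
    where open ≡-Reasoning

  filter-R : filter (∁? inL?) (L ++ R) ≡ R
  filter-R = begin
    filter (∁? inL?) (L ++ R)           ≡⟨ filter-++ (∁? inL?) L R ⟩
    filter (∁? inL?) L ++ filter (∁? inL?) R
      ≡⟨ cong₂ _++_ (filter-none (∁? inL?) (All.tabulate (λ a∈L a∉L → a∉L a∈L)))
                    (filter-all (∁? inL?) (All.tabulate (λ a∈R a∈L → disjoint _ a∈L a∈R))) ⟩
    R                                   ∎
    where open ≡-Reasoning

  -- Words whose L-letters all precede their other letters; every word
  -- derived in an SLP for L ++ R is a factor of L ++ R, hence Ordered.
  Ordered : List A → Set
  Ordered = AllPairs (λ a b → b ∈ L → a ∈ L)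

  ordered-split : ∀ u v → Ordered (u ++ v) → Ordered u × Ordered v
  ordered-split u v ordered = let (u-ordered , v-ordered , _) = allPairs-++⁻ u ordered in u-ordered , v-ordered

  L++R-ordered : Ordered (L ++ R)
  L++R-ordered = allPairs-++⁺ (allPairs-of (λ a∈L _ _ → a∈L))
                              (allPairs-of (λ _ b∈R b∈L → ⊥-elim (disjoint _ b∈L b∈R)))
                              (All.tabulate (λ a∈L → All.tabulate (λ _ _ → a∈L)))

  -- The projection onto L-letters takes every rule whose children both keep
  -- an L-letter; the projection onto the other letters refuses exactly those.
  NotChargedToL : List A → List A → Set
  NotChargedToL u v = filter inL? u ≡ [] ⊎ filter inL? v ≡ []

  notChargedToL? : ∀ u v → Dec (NotChargedToL u v)
  notChargedToL? u v = ≡-dec _≟_ (filter inL? u) [] ⊎-dec ≡-dec _≟_ (filter inL? v) []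

  -- A refused rule has an L-letter in v; in an Ordered word u ++ v all of u
  -- then lies in L, so u keeps no letter in the projection onto the others.
  refusal-sound : ∀ u v → ¬ NotChargedToL u v → Ordered (u ++ v) →
    filter (∁? inL?) u ≢ [] → filter (∁? inL?) v ≢ [] → ⊥
  refusal-sound u v charged ordered u-has-other _ =
    u-has-other (filter-none (∁? inL?) (All.map in-L across))
    where
    across : All (λ a → All (λ b → b ∈ L → a ∈ L) v) u
    across = proj₂ (proj₂ (allPairs-++⁻ u ordered))
    in-L : ∀ {a} → All (λ b → b ∈ L → a ∈ L) v → ¬ ¬ a ∈ L
    in-L before a∉L = charged (inj₂ (filter-none inL? (All.map (λ b∈L⇒a∈L b∈L → a∉L (b∈L⇒a∈L b∈L)) before)))

  module ProjL = Projection inL? {Keep = λ _ _ → ⊤} (λ _ _ → yes tt)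
  module ProjR = Projection (∁? inL?) notChargedToL?
  module CorrectL = ProjL.Correctness (λ _ → ⊤) (λ _ _ _ → tt , tt) (λ _ _ refused _ _ _ → refused tt)
  module CorrectR = ProjR.Correctness Ordered ordered-split refusal-sound

  only-R-grows : ∀ {k} (QL : ProjL.Proj k) (QR : ProjR.Proj k) mxR myR bR →
    ProjL.nts QL + ProjR.nts QR ≤ k → ProjL.nts QL + ProjR.nts (ProjR.addRule QR mxR myR bR) ≤ suc k
  only-R-grows QL QR mxR myR bR counted = begin
    ProjL.nts QL + ProjR.nts (ProjR.addRule QR mxR myR bR) ≤⟨ +-monoʳ-≤ (ProjL.nts QL) (ProjR.addRule-size QR mxR myR bR) ⟩
    ProjL.nts QL + suc (ProjR.nts QR)                      ≡⟨ +-suc (ProjL.nts QL) (ProjR.nts QR) ⟩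
    suc (ProjL.nts QL + ProjR.nts QR)                      ≤⟨ s≤s counted ⟩
    suc _                                                  ∎
    where open ≤-Reasoning

  count-step : ∀ {k} (QL : ProjL.Proj k) (QR : ProjR.Proj k) mxL myL mxR myR bR →
    (∀ {a b} → mxL ≡ just a → myL ≡ just b → bR ≡ false) →
    ProjL.nts QL + ProjR.nts QR ≤ k →
    ProjL.nts (ProjL.addRule QL mxL myL true) + ProjR.nts (ProjR.addRule QR mxR myR bR) ≤ suc k
  count-step QL QR (just a) (just b) mxR myR bR refused counted
    rewrite refused refl refl | ProjR.addRule-refused QR mxR myR = s≤s counted
  count-step QL QR (just a) nothing  mxR myR bR _ counted = only-R-grows QL QR mxR myR bR counted
  count-step QL QR nothing  myL      mxR myR bR _ counted = only-R-grows QL QR mxR myR bR counted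

  count : ∀ {k} (rs : Rules A k) → ProjL.nts (ProjL.project rs) + ProjR.nts (ProjR.project rs) ≤ k
  count [] = z≤n
  count (rs ▷ (x , y)) =
    count-step QL QR (ProjL.image QL x) (ProjL.image QL y) (ProjR.image QR x) (ProjR.image QR y) _
      (λ x↦a y↦b → dec-false (notChargedToL? (expand rs x) (expand rs y))
                     [ CorrectL.image-nonempty rs x tt x↦a , CorrectL.image-nonempty rs y tt y↦b ]′)
      (count rs)
    where
    QL : ProjL.Proj _
    QL = ProjL.project rs
    QR : ProjR.Proj _
    QR = ProjR.project rs

  L-part : ∀ {w} → w ≡ L ++ R → filter inL? w ≡ L
  L-part w≡ = trans (cong (filter inL?) w≡) filter-L

  R-part : ∀ {w} → w ≡ L ++ R → filter (∁? inL?) w ≡ R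
  R-part w≡ = trans (cong (filter (∁? inL?)) w≡) filter-R

  split-slp : (G : SLP A) → generates G ≡ L ++ R → L ≢ [] → R ≢ [] →
    Σ (SLP A) λ GL → Σ (SLP A) λ GR →
      generates GL ≡ L × generates GR ≡ R × size _≟_ GL + size _≟_ GR ≤ size _≟_ G
  split-slp G G⇒LR L≢[] R≢[]
    with CorrectL.project-slp G tt (L≢[] ∘ trans (sym (L-part G⇒LR)))
       | CorrectR.project-slp G (subst Ordered (sym G⇒LR) L++R-ordered) (R≢[] ∘ trans (sym (R-part G⇒LR)))
  ... | GL , GL⇒ , ntsL , termsL | GR , GR⇒ , ntsR , termsR =
    GL , GR , trans GL⇒ (L-part G⇒LR) , trans GR⇒ (R-part G⇒LR) , sizes
    where
    open ≤-Reasoning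
    #terms : SLP A → ℕ
    #terms H = length (deduplicate _≟_ (terminals H))
    sizes : size _≟_ GL + size _≟_ GR ≤ size _≟_ G
    sizes = begin
      (#terms GL + nNT GL) + (#terms GR + nNT GR)
        ≡⟨ interchange +-commutativeSemigroup (#terms GL) (nNT GL) (#terms GR) (nNT GR) ⟩
      (#terms GL + #terms GR) + (nNT GL + nNT GR)
        ≤⟨ +-mono-≤ (distinct-split-length _≟_ inL? {zs = terminals G} termsL termsR)
                    (≤-trans (≤-reflexive (cong₂ _+_ ntsL ntsR)) (count (rules G))) ⟩
      #terms G + nNT G ∎

lemma8 : {A : Set} (_≟_ : DecidableEquality A) (L R : List A) →
    L ≢ [] → R ≢ [] →
    (∀ a → a ∈ L → a ∈ R → ⊥) →
    (sL sR sS : ℕ) → IsSlp _≟_ L sL → IsSlp _≟_ R sR → IsSlp _≟_ (L ++ R) sS →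
    sL + sR ≤ sS
lemma8 _≟_ L R L≢[] R≢[] disjoint sL sR sS (_ , minimalL) (_ , minimalR) ((G , G⇒LR , size≡sS) , _)
  with Split.split-slp _≟_ L R disjoint G G⇒LR L≢[] R≢[]
... | GL , GR , GL⇒L , GR⇒R , sizes = begin
  sL + sR                   ≤⟨ +-mono-≤ (minimalL GL GL⇒L) (minimalR GR GR⇒R) ⟩
  size _≟_ GL + size _≟_ GR ≤⟨ sizes ⟩
  size _≟_ G                ≡⟨ size≡sS ⟩
  sS                        ∎
  where open ≤-Reasoning
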